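{- Let $\langle D;<\rangle$ be a (strict) linear order. Then $\langle D;<\rangle$ satisfies the scheme $\mathtt{DCI}$ if and only if it satisfies the scheme $\mathtt{DCI}_2$.
   Context: All formulas are first-order formulas in the language $\{<\}$; a scheme "holds" in a structure if every instance (with any further free variables of $\varphi$ read universally, i.e. as parameters) is true in it. The scheme $\mathtt{DCI}$ consists of all sentences $$\exists x\,\forall y\!<\!x\,\varphi(y)\;\wedge\;\forall x\big[\forall y\!<\!x\,\varphi(y)\rightarrow\exists z\!>\!x\,\forall y\!<\!z\,\varphi(y)\big]\longrightarrow\forall x\,\varphi(x),$$ for arbitrary formulas $\varphi$. The scheme $\mathtt{DCI}_2$ consists of all sentences $$\exists x\,\forall y\!\leqslant\!x\,\varphi(y)\;\wedge\;\forall x\big[\forall y\!\leqslant\!x\,\varphi(y)\rightarrow\exists z\!>\!x\,\forall y\!<\!z\,\varphi(y)\big]\;\wedge\;\forall x\big[\forall y\!<\!x\,\varphi(y)\rightarrow\varphi(x)\big]\longrightarrow\forall x\,\varphi(x),$$ for arbitrary formulas $\varphi$. -}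

module Defs where

open import Data.Nat using (ℕ; zero; suc)
open import Data.Empty using (⊥)
open import Data.Product using (Σ; _×_)
open import Data.Sum using (_⊎_)
open import Relation.Binary.PropositionalEquality using (_≡_)

-- First-order formulas in the language {<} (with equality),
-- variables as de Bruijn indices.
data Formula : Set where
  _≺_  : ℕ → ℕ → Formula
  _≐_  : ℕ → ℕ → Formula
  ⊥'   : Formula
  _⇒_  : Formula → Formula → Formula
  _∧'_ : Formula → Formula → Formula
  _∨'_ : Formula → Formula → Formula
  ∀'   : Formula → Formula
  ∃'   : Formula → Formula

¬' : Formula → Formula
¬' φ = φ ⇒ ⊥'

Env : Set → Set
Env D = ℕ → D

_∷ₑ_ : {D : Set} → D → Env D → Env D
(d ∷ₑ ρ) zero    = d
(d ∷ₑ ρ) (suc n) = ρ n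

Sat : (D : Set) → (D → D → Set) → Formula → Env D → Set
Sat D _<_ (i ≺ j)  ρ = ρ i < ρ j
Sat D _<_ (i ≐ j)  ρ = ρ i ≡ ρ j
Sat D _<_ ⊥'       ρ = ⊥
Sat D _<_ (φ ⇒ ψ)  ρ = Sat D _<_ φ ρ → Sat D _<_ ψ ρ
Sat D _<_ (φ ∧' ψ) ρ = Sat D _<_ φ ρ × Sat D _<_ ψ ρ
Sat D _<_ (φ ∨' ψ) ρ = Sat D _<_ φ ρ ⊎ Sat D _<_ ψ ρ
Sat D _<_ (∀' φ)   ρ = (d : D) → Sat D _<_ φ (d ∷ₑ ρ)
Sat D _<_ (∃' φ)   ρ = Σ D λ d → Sat D _<_ φ (d ∷ₑ ρ)

record IsStrictLinearOrder (D : Set) (_<_ : D → D → Set) : Set where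
  field
    irrefl  : ∀ x → (x < x → ⊥)
    trans   : ∀ {x y z} → x < y → y < z → x < z
    connex  : ∀ x y → (x < y) ⊎ ((x ≡ y) ⊎ (y < x))

module _ {D : Set} (_<_ : D → D → Set) where

  _≤_ : D → D → Set
  x ≤ y = (x < y) ⊎ (x ≡ y)

  DCI-inst : (D → Set) → Set
  DCI-inst P =
    Σ D (λ x → ∀ y → y < x → P y)
    × (∀ x → (∀ y → y < x → P y) → Σ D (λ z → x < z × (∀ y → y < z → P y)))
    → ∀ x → P x

  DCI₂-inst : (D → Set) → Set
  DCI₂-inst P =
    Σ D (λ x → ∀ y → y ≤ x → P y)
    × (∀ x → (∀ y → y ≤ x → P y) → Σ D (λ z → x < z × (∀ y → y < z → P y)))
    × (∀ x → (∀ y → y < x → P y) → P x)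
    → ∀ x → P x

-- The structure satisfies the scheme: every instance, for every formula φ
-- (free variable 0 playing the role of y) and every choice of parameters ρ.
SatDCI : (D : Set) → (D → D → Set) → Set
SatDCI D _<_ = (φ : Formula) (ρ : Env D) → DCI-inst _<_ (λ y → Sat D _<_ φ (y ∷ₑ ρ))

SatDCI₂ : (D : Set) → (D → D → Set) → Set
SatDCI₂ D _<_ = (φ : Formula) (ρ : Env D) → DCI₂-inst _<_ (λ y → Sat D _<_ φ (y ∷ₑ ρ))

module Submission where

-- DCI ⇒ DCI₂ holds instance by instance: the hypotheses of the DCI₂ instance
-- for P imply those of the DCI instance for P (the third DCI₂ hypothesis
-- turns "all y < x satisfy P" into "all y ≤ x satisfy P").
--
-- DCI₂ ⇒ DCI uses a different instance: to prove DCI for P we apply DCI₂ to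
-- the predicate  Below P x = ∀ y < x, P y.  Transitivity of < shows that the
-- DCI hypotheses for P yield the DCI₂ hypotheses for Below P, so every x has
-- Below P x, and one more step past x gives P x.  For this to be an instance
-- of the scheme, Below P must be first-order definable when P is: it is
-- defined by  ∀y (y < x → φ(y)),  where φ has to be shifted past the new
-- bound variable.

open import Defs
open import Level using (0ℓ)
open import Axiom.ExcludedMiddle using (ExcludedMiddle)
open import Function.Bundles using (_⇔_; mk⇔; Equivalence)
open import Data.Nat using (ℕ; zero; suc)
open import Data.Product using (Σ; _×_; _,_)
open import Data.Sum using (inj₁; inj₂)
open import Relation.Binary.PropositionalEquality
  using (_≡_; refl; sym; subst₂)

open Equivalence using (to; from)

lift : (ℕ → ℕ) → ℕ → ℕ
lift f zero    = zero
lift f (suc n) = suc (f n)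

rename : (ℕ → ℕ) → Formula → Formula
rename f (i ≺ j)  = f i ≺ f j
rename f (i ≐ j)  = f i ≐ f j
rename f ⊥'       = ⊥'
rename f (φ ⇒ ψ)  = rename f φ ⇒ rename f ψ
rename f (φ ∧' ψ) = rename f φ ∧' rename f ψ
rename f (φ ∨' ψ) = rename f φ ∨' rename f ψ
rename f (∀' φ)   = ∀' (rename (lift f) φ)
rename f (∃' φ)   = ∃' (rename (lift f) φ)

module _ {D : Set} (_<_ : D → D → Set) where

  lift-agree : (f : ℕ → ℕ) {ρ σ : Env D} (d : D) →
               (∀ n → ρ n ≡ σ (f n)) →
               ∀ n → (d ∷ₑ ρ) n ≡ (d ∷ₑ σ) (lift f n)
  lift-agree f d agree zero    = refl
  lift-agree f d agree (suc n) = agree n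

  sat-rename : (φ : Formula) (f : ℕ → ℕ) (ρ σ : Env D) →
               (∀ n → ρ n ≡ σ (f n)) →
               Sat D _<_ φ ρ ⇔ Sat D _<_ (rename f φ) σ
  sat-rename (i ≺ j) f ρ σ agree =
    mk⇔ (subst₂ _<_ (agree i) (agree j)) (subst₂ _<_ (sym (agree i)) (sym (agree j)))
  sat-rename (i ≐ j) f ρ σ agree =
    mk⇔ (subst₂ _≡_ (agree i) (agree j)) (subst₂ _≡_ (sym (agree i)) (sym (agree j)))
  sat-rename ⊥' f ρ σ agree = mk⇔ (λ ()) (λ ())
  sat-rename (φ ⇒ ψ) f ρ σ agree =
    mk⇔ (λ h x → to   IHψ (h (from IHφ x)))
        (λ h x → from IHψ (h (to   IHφ x)))
    where
    IHφ : Sat D _<_ φ ρ ⇔ Sat D _<_ (rename f φ) σ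
    IHφ = sat-rename φ f ρ σ agree
    IHψ : Sat D _<_ ψ ρ ⇔ Sat D _<_ (rename f ψ) σ
    IHψ = sat-rename ψ f ρ σ agree
  sat-rename (φ ∧' ψ) f ρ σ agree =
    mk⇔ (λ { (x , y) → to   IHφ x , to   IHψ y })
        (λ { (x , y) → from IHφ x , from IHψ y })
    where
    IHφ : Sat D _<_ φ ρ ⇔ Sat D _<_ (rename f φ) σ
    IHφ = sat-rename φ f ρ σ agree
    IHψ : Sat D _<_ ψ ρ ⇔ Sat D _<_ (rename f ψ) σ
    IHψ = sat-rename ψ f ρ σ agree
  sat-rename (φ ∨' ψ) f ρ σ agree =
    mk⇔ (λ { (inj₁ x) → inj₁ (to   IHφ x) ; (inj₂ y) → inj₂ (to   IHψ y) })
        (λ { (inj₁ x) → inj₁ (from IHφ x) ; (inj₂ y) → inj₂ (from IHψ y) })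
    where
    IHφ : Sat D _<_ φ ρ ⇔ Sat D _<_ (rename f φ) σ
    IHφ = sat-rename φ f ρ σ agree
    IHψ : Sat D _<_ ψ ρ ⇔ Sat D _<_ (rename f ψ) σ
    IHψ = sat-rename ψ f ρ σ agree
  sat-rename (∀' φ) f ρ σ agree =
    mk⇔ (λ h d → to   (IH d) (h d)) (λ h d → from (IH d) (h d))
    where
    IH : ∀ d → Sat D _<_ φ (d ∷ₑ ρ) ⇔ Sat D _<_ (rename (lift f) φ) (d ∷ₑ σ)
    IH d = sat-rename φ (lift f) (d ∷ₑ ρ) (d ∷ₑ σ) (lift-agree f d agree)
  sat-rename (∃' φ) f ρ σ agree =
    mk⇔ (λ { (d , x) → d , to   (IH d) x }) (λ { (d , x) → d , from (IH d) x })
    where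
    IH : ∀ d → Sat D _<_ φ (d ∷ₑ ρ) ⇔ Sat D _<_ (rename (lift f) φ) (d ∷ₑ σ)
    IH d = sat-rename φ (lift f) (d ∷ₑ ρ) (d ∷ₑ σ) (lift-agree f d agree)

  Below : (D → Set) → D → Set
  Below P x = ∀ y → y < x → P y

skip1 : ℕ → ℕ
skip1 zero    = zero
skip1 (suc n) = suc (suc n)

-- The formula  ∀y (y < x → φ(y))  in the free variable x (index 0), with the
-- parameters of φ unchanged.
belowFormula : Formula → Formula
belowFormula φ = ∀' ((0 ≺ 1) ⇒ rename skip1 φ)

sat-belowFormula : {D : Set} (_<_ : D → D → Set) (φ : Formula) (ρ : Env D) (x : D) →
                   Sat D _<_ (belowFormula φ) (x ∷ₑ ρ) ⇔
                   Below _<_ (λ y → Sat D _<_ φ (y ∷ₑ ρ)) x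
sat-belowFormula {D} _<_ φ ρ x =
  mk⇔ (λ h y y<x → from (shift y) (h y y<x))
      (λ h y y<x → to   (shift y) (h y y<x))
  where
  agree : ∀ y n → (y ∷ₑ ρ) n ≡ (y ∷ₑ (x ∷ₑ ρ)) (skip1 n)
  agree y zero    = refl
  agree y (suc n) = refl
  shift : ∀ y → Sat D _<_ φ (y ∷ₑ ρ) ⇔ Sat D _<_ (rename skip1 φ) (y ∷ₑ (x ∷ₑ ρ))
  shift y = sat-rename _<_ φ skip1 (y ∷ₑ ρ) (y ∷ₑ (x ∷ₑ ρ)) (agree y)

module _ {D : Set} {_<_ : D → D → Set} where

  dci⇒dci₂ : (P : D → Set) → DCI-inst _<_ P → DCI₂-inst _<_ P
  dci⇒dci₂ P dci ((x₀ , base) , step , closed) = dci ((x₀ , base<) , step<)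
    where
    base< : Below _<_ P x₀
    base< y y<x₀ = base y (inj₁ y<x₀)
    step< : ∀ x → Below _<_ P x → Σ D (λ z → x < z × Below _<_ P z)
    step< x below = step x λ { y (inj₁ y<x) → below y y<x
                             ; y (inj₂ refl) → closed x below }

  dci₂-below⇒dci : (∀ {x y z} → x < y → y < z → x < z) →
                   (P Q : D → Set) → (∀ x → Q x ⇔ Below _<_ P x) →
                   DCI₂-inst _<_ Q → DCI-inst _<_ P
  dci₂-below⇒dci trans P Q Q⇔Below dci₂ ((x₀ , base) , step) x =
    let (z , x<z , belowZ) = step x (to (Q⇔Below x) (allQ x)) in belowZ x x<z
    where
    down : ∀ {u v} → Below _<_ P v → u < v → Below _<_ P u
    down below u<v w w<u = below w (trans w<u u<v)
    toQ : ∀ u → Below _<_ P u → Q u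
    toQ u = from (Q⇔Below u)
    allQ : ∀ u → Q u
    allQ = dci₂
      ( (x₀ , λ { u (inj₁ u<x₀) → toQ u (down base u<x₀) ; u (inj₂ refl) → toQ u base })
      , (λ u below →
          let (z , u<z , belowZ) = step u (to (Q⇔Below u) (below u (inj₂ refl)))
          in z , u<z , λ v v<z → toQ v (down belowZ v<z))
      , (λ u below → toQ u λ v v<u →
          let (z , v<z , belowZ) = step v (to (Q⇔Below v) (below v v<u))
          in belowZ v v<z) )

theorem2p7 : ExcludedMiddle 0ℓ → (D : Set) (_<_ : D → D → Set) →
    IsStrictLinearOrder D _<_ → SatDCI D _<_ ⇔ SatDCI₂ D _<_
theorem2p7 _ D _<_ order = mk⇔
  (λ dci φ ρ → dci⇒dci₂ _ (dci φ ρ))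
  (λ dci₂ φ ρ → dci₂-below⇒dci (IsStrictLinearOrder.trans order) _ _
                  (sat-belowFormula _<_ φ ρ) (dci₂ (belowFormula φ) ρ))
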